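{- Let $T$ be a tree with vertex set $[n]$, $n\ge 2$, and let $p=p^{(3)}_T$ be its Steiner $3$-form. For any values $a_3,\ldots,a_n \in \mathbb{C}$ there exist $a_1,a_2\in\mathbb{C}$ such that $(a_1,\ldots,a_n)$ is a Steiner nullvector, i.e. $\frac{\partial p}{\partial x_r}(a_1,\ldots,a_n)=0$ for all $r\in[n]$.
   Context: For a graph $G$ and a set $S \subseteq V(G)$, the Steiner distance $d_G(S)$ (written $d_G(v_1,\ldots,v_m)$ for $S=\{v_1,\ldots,v_m\}$, repetitions allowed) is the minimum number of edges in a connected subgraph of $G$ containing all of $S$; in particular $d_G(\{v\})=0$. The Steiner $3$-form of $T$ is $p^{(3)}_T(x)=\sum_{v_1,v_2,v_3\in[n]} d_T(v_1,v_2,v_3)\,x_{v_1}x_{v_2}x_{v_3}$. -}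

module Defs where

open import Level using (Level; _⊔_)
open import Data.Nat as ℕ using (ℕ; zero; suc; _≤_)
open import Data.Fin using (Fin; zero; suc; toℕ; _≟_)
open import Data.Bool using (Bool; true; false; _∧_; if_then_else_)
open import Data.List using (List; []; _∷_; _++_; length; map; allFin)
open import Data.Nat.ListAction using (sum)
open import Data.List.Relation.Unary.Unique.Propositional using (Unique)
open import Data.List.Relation.Unary.Linked using (Linked)
open import Data.List.Relation.Unary.All using (All)
open import Data.Product using (Σ; ∃; _×_; _,_)
open import Relation.Nullary using (¬_; yes; no)
open import Relation.Binary.PropositionalEquality using (_≡_)
open import Algebra.Bundles using (CommutativeRing)

record Graph (n : ℕ) : Set where
  field
    adj    : Fin n → Fin n → Bool
    sym    : ∀ u v → adj u v ≡ adj v u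
    irrefl : ∀ u → adj u u ≡ false
open Graph public

data Walk {n : ℕ} (E : Fin n → Fin n → Bool) : Fin n → Fin n → Set where
  nil  : ∀ {u} → Walk E u u
  cons : ∀ {u w v} → E u w ≡ true → Walk E w v → Walk E u v

Connected : ∀ {n} → Graph n → Set
Connected G = ∀ u v → Walk (adj G) u v

record Cycle {n : ℕ} (G : Graph n) : Set where
  field
    v0     : Fin n
    rest   : List (Fin n)
    long   : 2 ≤ length rest
    unique : Unique (v0 ∷ rest)
    closed : Linked (λ a b → adj G a b ≡ true) (v0 ∷ rest ++ (v0 ∷ []))

IsTree : ∀ {n} → Graph n → Set
IsTree G = Connected G × ¬ Cycle G

record Subgraph {n : ℕ} (G : Graph n) : Set where
  field
    W     : Fin n → Bool
    F     : Fin n → Fin n → Bool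
    F-sym : ∀ u v → F u v ≡ F v u
    F-sub : ∀ u v → F u v ≡ true → adj G u v ≡ true
    F-end : ∀ u v → F u v ≡ true → W u ≡ true
open Subgraph public

SubConnected : ∀ {n} {G : Graph n} → Subgraph G → Set
SubConnected H = ∀ u v → W H u ≡ true → W H v ≡ true → Walk (F H) u v

edgeCount : ∀ {n} → (Fin n → Fin n → Bool) → ℕ
edgeCount {n} E =
  sum (map (λ u → sum (map (λ v →
     if (toℕ u ℕ.<ᵇ toℕ v) ∧ E u v then 1 else 0) (allFin n))) (allFin n))

Spans : ∀ {n} {G : Graph n} → Subgraph G → List (Fin n) → Set
Spans H S = SubConnected H × All (λ v → W H v ≡ true) S

IsSteinerDistance : ∀ {n} → Graph n → List (Fin n) → ℕ → Set
IsSteinerDistance G S k =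
  (Σ (Subgraph G) λ H → Spans H S × edgeCount (F H) ≡ k) ×
  (∀ (H : Subgraph G) → Spans H S → k ≤ edgeCount (F H))

module _ {c ℓ : Level} (R : CommutativeRing c ℓ) where
  open CommutativeRing R using (Carrier; _≈_; _+_; _*_; 0#; 1#)

  natCast : ℕ → Carrier
  natCast zero    = 0#
  natCast (suc k) = 1# + natCast k

  pow : Carrier → ℕ → Carrier
  pow x zero    = 1#
  pow x (suc k) = x * pow x k

  sumFin : ∀ {n} → (Fin n → Carrier) → Carrier
  sumFin {zero}  f = 0#
  sumFin {suc n} f = f zero + sumFin (λ i → f (suc i))

  IsFieldR : Set (c ⊔ ℓ)
  IsFieldR = (¬ (0# ≈ 1#)) × (∀ x → ¬ (x ≈ 0#) → ∃ λ y → x * y ≈ 1#)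

  AlgClosed : Set (c ⊔ ℓ)
  AlgClosed = ∀ (k : ℕ) (cs : Fin (suc k) → Carrier) →
    ∃ λ x → (pow x (suc k) + sumFin (λ i → cs i * pow x (toℕ i))) ≈ 0#

  CharZero : Set ℓ
  CharZero = ∀ (k : ℕ) → ¬ (natCast (suc k) ≈ 0#)

  δ : ∀ {n} → Fin n → Fin n → Carrier
  δ u v with u ≟ v
  ... | yes _ = 1#
  ... | no  _ = 0#

  steiner3Form : ∀ {n} → (Fin n → Fin n → Fin n → ℕ) → (Fin n → Carrier) → Carrier
  steiner3Form d x = sumFin λ v1 → sumFin λ v2 → sumFin λ v3 →
    natCast (d v1 v2 v3) * (x v1 * x v2 * x v3)

  steiner3Partial : ∀ {n} → (Fin n → Fin n → Fin n → ℕ) → (Fin n → Carrier) → Fin n → Carrier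
  steiner3Partial d x r = sumFin λ v1 → sumFin λ v2 → sumFin λ v3 →
    natCast (d v1 v2 v3) *
      (δ v1 r * (x v2 * x v3) + δ v2 r * (x v1 * x v3) + δ v3 r * (x v1 * x v2))

-- the vector (a1, a2, a3, ..., an) on [n] = Fin (2 + m)
extend : ∀ {a} {A : Set a} {m : ℕ} → A → A → (Fin m → A) → Fin (suc (suc m)) → A
extend a1 a2 a zero          = a1
extend a1 a2 a (suc zero)    = a2
extend a1 a2 a (suc (suc i)) = a i

{-# OPTIONS --safe #-}
-- In a tree, every connected subgraph containing u, v, w contains each edge whose removal
-- separates two of u, v, w, and these edges alone form such a subgraph; so d(u,v,w) counts them,
-- and counting edge by edge gives 2 d(u,v,w) = D(u,v) + D(v,w) + D(u,w), where D(u,v) = d(u,v,v).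
-- This identity rewrites 2 ∂p/∂x_r as a sum of terms each of which is a multiple of Σ x or of
-- Q(x) = Σ D(a,b) x_a x_b, so every x with Σ x = 0 and Q(x) = 0 is a nullvector.
-- Given a₃, …, aₙ, every x = y + t z with y = (0, −Σ a, a₃, …, aₙ) and z = (1, −1, 0, …, 0) has
-- Σ x = 0, and Q(y + t z) is a quadratic polynomial in t with leading coefficient
-- Q(z) = −(D(1,2) + D(2,1)), nonzero in characteristic zero; a root t gives a₁ and a₂.
module Submission where

open import Defs hiding (sym)
open import Level using (Level)
open import Data.Nat using (ℕ; zero; suc)
open import Data.Fin using (Fin; zero; suc)
open import Data.List using (_∷_; [])
open import Data.Product using (∃; _,_)
open import Algebra.Bundles using (CommutativeRing)

module SteinerTrees where

  open import Level using (0ℓ)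
  open import Data.Nat as ℕ using (_+_; _≤_; z≤n; s≤s)
  open import Data.Nat.Properties
    using (≤-refl; ≤-trans; ≤-antisym; +-mono-≤; m≤m+n; m≤n+m; <⇒<ᵇ; +-commutativeSemigroup)
  open import Data.Nat.ListAction using (sum)
  open import Algebra.Properties.CommutativeSemigroup +-commutativeSemigroup using (interchange)
  open import Data.List.Properties using (map-cong)
  open import Data.List.Membership.Propositional.Properties using (∈-allFin)
  open import Data.Fin using (toℕ; _≟_)
  import Data.Fin as Fin
  import Data.Fin.Properties as Fin
  import Data.Bool as Bool
  open import Data.Bool using (Bool; true; false; not; _∧_; _∨_; _xor_; T; if_then_else_)
  open import Data.Bool.Properties using (not-injective)
  open import Data.List using (List; _++_; map; allFin)
  open import Data.List.Relation.Unary.All using (All; []; _∷_)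
  open import Data.List.Relation.Unary.All.Properties using (¬Any⇒All¬)
  open import Data.List.Relation.Unary.Any using (here; there)
  open import Data.List.Relation.Unary.Linked using (Linked; [-]; _∷_)
  open import Data.List.Relation.Unary.Unique.Propositional using (Unique)
  open import Data.List.Relation.Unary.AllPairs using ([]; _∷_)
  open import Data.List.Membership.Propositional using (_∈_)
  import Data.List.Membership.DecPropositional as DecMembership
  open import Data.Product as Prod using (_×_; proj₁; proj₂)
  open import Data.Sum as Sum using (_⊎_; inj₁; inj₂)
  open import Data.Empty using (⊥-elim)
  open import Function using (_∘_; const)
  open import Relation.Nullary using (¬_; yes; no; Dec; does; contradiction)
  open import Relation.Nullary.Decidable using (_×-dec_; _⊎-dec_; dec-true)
  open import Relation.Binary using (Rel; Symmetric; _⇒_; tri<; tri≈; tri>)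
  open import Relation.Binary.PropositionalEquality
    using (_≡_; _≢_; refl; sym; trans; cong; cong₂; module ≡-Reasoning)
  open import Relation.Binary.Construct.Closure.ReflexiveTransitive as Star
    using (Star; ε; _◅_; _◅◅_)

  module _ {n : ℕ} where

    Walk⇒Star : ∀ {E : Fin n → Fin n → Bool} {u v} → Walk E u v → Star (λ a b → E a b ≡ true) u v
    Walk⇒Star nil        = ε
    Walk⇒Star (cons e p) = e ◅ Walk⇒Star p

    Star⇒Walk : ∀ {E : Fin n → Fin n → Bool} {u v} → Star (λ a b → E a b ≡ true) u v → Walk E u v
    Star⇒Walk ε        = nil
    Star⇒Walk (e ◅ p) = cons e (Star⇒Walk p)

    data Path (R : Rel (Fin n) 0ℓ) : Fin n → List (Fin n) → Fin n → Set where
      ε   : ∀ {u} → Path R u [] u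
      _◅_ : ∀ {u w vs v} → R u w → Path R w vs v → Path R u (w ∷ vs) v

    SimplePath : Rel (Fin n) 0ℓ → Fin n → Fin n → Set
    SimplePath R u v = ∃ λ vs → Path R u vs v × Unique (u ∷ vs)

    module _ {R : Rel (Fin n) 0ℓ} where
      open DecMembership (_≟_ {n}) using (_∈?_)

      suffixFrom : ∀ {u w vs v} → Path R w vs v → Unique (w ∷ vs) → u ∈ w ∷ vs → SimplePath R u v
      suffixFrom p         unique       (here refl) = _ , p , unique
      suffixFrom (_ ◅ p) (_ ∷ unique) (there u∈) = suffixFrom p unique u∈

      simplePath : ∀ {u v} → Star R u v → SimplePath R u v
      simplePath ε = [] , ε , [] ∷ []
      simplePath {u} (_◅_ {j = w} e walk) with simplePath walk
      ... | vs , p , unique with u ∈? (w ∷ vs)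
      ...   | yes u∈ = suffixFrom p unique u∈
      ...   | no u∉  = w ∷ vs , e ◅ p , ¬Any⇒All¬ _ u∉ ∷ unique

  indicator : Bool → ℕ
  indicator b = if b then 1 else 0

  sum-map-mono : ∀ {A : Set} {f g : A → ℕ} → (∀ x → f x ≤ g x) → ∀ xs → sum (map f xs) ≤ sum (map g xs)
  sum-map-mono f≤g []       = ≤-refl
  sum-map-mono f≤g (x ∷ xs) = +-mono-≤ (f≤g x) (sum-map-mono f≤g xs)

  sum-map-+ : ∀ {A : Set} (f g : A → ℕ) xs → sum (map (λ x → f x + g x) xs) ≡ sum (map f xs) + sum (map g xs)
  sum-map-+ f g []       = refl
  sum-map-+ f g (x ∷ xs) = trans (cong (f x + g x +_) (sum-map-+ f g xs)) (interchange (f x) (g x) _ _)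

  ≤-sum-map : ∀ {A : Set} (f : A → ℕ) {x xs} → x ∈ xs → f x ≤ sum (map f xs)
  ≤-sum-map f {xs = _ ∷ xs} (here refl) = m≤m+n _ (sum (map f xs))
  ≤-sum-map f {xs = y ∷ _}  (there x∈)  = ≤-trans (≤-sum-map f x∈) (m≤n+m _ (f y))

  module _ {n : ℕ} where

    pairSum : (Fin n → Fin n → ℕ) → ℕ
    pairSum f = sum (map (λ u → sum (map (f u) (allFin n))) (allFin n))

    pairSum-mono : ∀ {f g} → (∀ u v → f u v ≤ g u v) → pairSum f ≤ pairSum g
    pairSum-mono f≤g = sum-map-mono (λ u → sum-map-mono (f≤g u) (allFin n)) (allFin n)

    pairSum-+ : ∀ f g → pairSum (λ u v → f u v + g u v) ≡ pairSum f + pairSum g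
    pairSum-+ f g = trans (cong sum (map-cong (λ u → sum-map-+ (f u) (g u) (allFin n)) (allFin n)))
                          (sum-map-+ _ _ (allFin n))

    pairSum-cong : ∀ {f g} → (∀ u v → f u v ≡ g u v) → pairSum f ≡ pairSum g
    pairSum-cong f≡g = cong sum (map-cong (λ u → cong sum (map-cong (f≡g u) (allFin n))) (allFin n))

    ≤-pairSum : ∀ f u v → f u v ≤ pairSum f
    ≤-pairSum f u v = ≤-trans (≤-sum-map (f u) (∈-allFin v)) (≤-sum-map _ (∈-allFin u))

    edgeIndicator : (Fin n → Fin n → Bool) → Fin n → Fin n → ℕ
    edgeIndicator E u v = indicator ((toℕ u ℕ.<ᵇ toℕ v) ∧ E u v)

    edgeCount-mono : ∀ {E E′} → (∀ u v → E u v ≡ true → E′ u v ≡ true) → edgeCount E ≤ edgeCount E′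
    edgeCount-mono {E} {E′} E⊆E′ = pairSum-mono λ u v → indicator-mono (toℕ u ℕ.<ᵇ toℕ v) (E⊆E′ u v)
      where
      indicator-mono : ∀ l {e e′} → (e ≡ true → e′ ≡ true) → indicator (l ∧ e) ≤ indicator (l ∧ e′)
      indicator-mono false           _    = ≤-refl
      indicator-mono true  {false}   _    = z≤n
      indicator-mono true  {true}    e⇒e′ rewrite e⇒e′ refl = ≤-refl

    edgeIndicator-pos : ∀ {E u v} → u Fin.< v → E u v ≡ true → 1 ≤ edgeIndicator E u v
    edgeIndicator-pos u<v = one≤ (<⇒<ᵇ u<v)
      where
      one≤ : ∀ {l e} → T l → e ≡ true → 1 ≤ indicator (l ∧ e)
      one≤ {true} _ refl = ≤-refl

    edgeCount-pos : ∀ {E p q} → E p q ≡ true → E q p ≡ true → p ≢ q → 1 ≤ edgeCount E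
    edgeCount-pos {E} {p} {q} pq qp p≢q with Fin.<-cmp p q
    ... | tri< p<q _   _   = ≤-trans (edgeIndicator-pos {E} p<q pq) (≤-pairSum (edgeIndicator E) p q)
    ... | tri≈ _   p≡q _   = ⊥-elim (p≢q p≡q)
    ... | tri> _   _   q<p = ≤-trans (edgeIndicator-pos {E} q<p qp) (≤-pairSum (edgeIndicator E) q p)

  IsSteinerDistance-unique : ∀ {n} {G : Graph n} {S k k′} →
    IsSteinerDistance G S k → IsSteinerDistance G S k′ → k ≡ k′
  IsSteinerDistance-unique ((H , spans , refl) , minimal) ((H′ , spans′ , refl) , minimal′) =
    ≤-antisym (minimal H′ spans′) (minimal′ H spans)

  IsSteinerDistance-pos : ∀ {n} {G : Graph n} {a b S k} →
    IsSteinerDistance G (a ∷ b ∷ S) k → a ≢ b → 1 ≤ k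
  IsSteinerDistance-pos {G = G} ((H , (connectedH , a∈ ∷ b∈ ∷ _) , refl) , _) a≢b
    with connectedH _ _ a∈ b∈
  ... | nil = ⊥-elim (a≢b refl)
  ... | cons {w = a′} e _ = edgeCount-pos e (trans (F-sym H a′ _) e) a≢a′
    where
    a≢a′ : _ ≢ a′
    a≢a′ refl with () ← trans (sym (F-sub H _ _ e)) (irrefl G _)

  from-does : ∀ {p} {P : Set p} (p? : Dec P) → does p? ≡ true → P
  from-does (yes p) _ = p

  splits : Bool → Bool → Bool → Bool
  splits a b c = (a xor b) ∨ (a xor c)

  splits⇒≢ : ∀ a b c → splits a b c ≡ true → a ≢ b ⊎ a ≢ c
  splits⇒≢ true  false _     _ = inj₁ λ ()
  splits⇒≢ false true  _     _ = inj₁ λ ()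
  splits⇒≢ true  true  false _ = inj₂ λ ()
  splits⇒≢ false false true  _ = inj₂ λ ()

  ≢⇒splitsˡ : ∀ {a b} c → a ≢ b → splits a b c ≡ true
  ≢⇒splitsˡ {true}  {true}  _ a≢b = ⊥-elim (a≢b refl)
  ≢⇒splitsˡ {false} {false} _ a≢b = ⊥-elim (a≢b refl)
  ≢⇒splitsˡ {true}  {false} _ _   = refl
  ≢⇒splitsˡ {false} {true}  _ _   = refl

  ≢⇒splitsʳ : ∀ {a c} b → a ≢ c → splits a b c ≡ true
  ≢⇒splitsʳ {true}  {true}  _ a≢c = ⊥-elim (a≢c refl)
  ≢⇒splitsʳ {false} {false} _ a≢c = ⊥-elim (a≢c refl)
  ≢⇒splitsʳ {true}  {false} true  _ = refl
  ≢⇒splitsʳ {true}  {false} false _ = refl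
  ≢⇒splitsʳ {false} {true}  true  _ = refl
  ≢⇒splitsʳ {false} {true}  false _ = refl

  splits-count : ∀ a b c → indicator (splits a b c) + indicator (splits a b c) ≡
    indicator (splits a b b) + indicator (splits b c c) + indicator (splits a c c)
  splits-count true  true  true  = refl
  splits-count true  true  false = refl
  splits-count true  false true  = refl
  splits-count true  false false = refl
  splits-count false true  true  = refl
  splits-count false true  false = refl
  splits-count false false true  = refl
  splits-count false false false = refl

  splits-not : ∀ a b c → splits (not a) (not b) (not c) ≡ splits a b c
  splits-not true  true  true  = refl
  splits-not true  true  false = refl
  splits-not true  false _     = refl
  splits-not false true  _     = refl
  splits-not false false true  = refl
  splits-not false false false = refl

  module Tree {n : ℕ} (T : Graph n) (connected : Connected T) (acyclic : ¬ Cycle T) where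

    Adj : Rel (Fin n) 0ℓ
    Adj a b = adj T a b ≡ true

    Adj-sym : Symmetric Adj
    Adj-sym {a} {b} = trans (Graph.sym T b a)

    Adj-irrefl : ∀ {a} → ¬ Adj a a
    Adj-irrefl {a} e with () ← trans (sym e) (irrefl T a)

    SameEdge : Fin n → Fin n → Rel (Fin n) 0ℓ
    SameEdge x y u w = (u ≡ x × w ≡ y) ⊎ (u ≡ y × w ≡ x)

    sameEdge? : ∀ x y u w → Dec (SameEdge x y u w)
    sameEdge? x y u w = (u ≟ x ×-dec w ≟ y) ⊎-dec (u ≟ y ×-dec w ≟ x)

    OtherEdge : Fin n → Fin n → Rel (Fin n) 0ℓ
    OtherEdge x y u w = Adj u w × ¬ SameEdge x y u w

    OtherEdge-sym : ∀ {x y} → Symmetric (OtherEdge x y)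
    OtherEdge-sym (e , other) = Adj-sym e , other ∘ Sum.swap ∘ Sum.map Prod.swap Prod.swap

    OtherEdge-swap : ∀ {x y} → OtherEdge y x ⇒ OtherEdge x y
    OtherEdge-swap (e , other) = e , other ∘ Sum.swap

    path-closes : ∀ {R u vs v t} → R ⇒ Adj → Path R u vs v → Adj v t → Linked Adj (u ∷ vs ++ t ∷ [])
    path-closes R⊆Adj ε       e = e ∷ [-]
    path-closes R⊆Adj (r ◅ p) e = R⊆Adj r ∷ path-closes R⊆Adj p e

    no-bypass : ∀ {x y} → Adj x y → ¬ Star (OtherEdge x y) x y
    no-bypass {x} {y} xy bypass with simplePath bypass
    ... | [] , ε , _ = Adj-irrefl xy
    ... | _ ∷ [] , (_ , other) ◅ ε , _ = other (inj₁ (refl , refl))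
    ... | vs@(_ ∷ _ ∷ _) , p , unique = acyclic record
      { v0 = x ; rest = vs ; long = s≤s (s≤s z≤n) ; unique = unique
      ; closed = path-closes proj₁ p (Adj-sym xy) }

    walkToEndpoint : ∀ x y z → Star (OtherEdge x y) z x ⊎ Star (OtherEdge x y) z y
    walkToEndpoint x y z = go (connected z x)
      where
      go : ∀ {z} → Walk (adj T) z x → Star (OtherEdge x y) z x ⊎ Star (OtherEdge x y) z y
      go nil = inj₁ ε
      go {z} (cons {w = w} e walk) with sameEdge? x y z w
      ... | yes (inj₁ (refl , _)) = inj₁ ε
      ... | yes (inj₂ (refl , _)) = inj₂ ε
      ... | no other = Sum.map ((e , other) ◅_) ((e , other) ◅_) (go walk)

    side : Fin n → Fin n → Fin n → Bool
    side x y z = Sum.[ const true , const false ] (walkToEndpoint x y z)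

    side-true : ∀ {x y z} → side x y z ≡ true → Star (OtherEdge x y) z x
    side-true {x} {y} {z} with walkToEndpoint x y z
    ... | inj₁ p = const p
    ... | inj₂ _ = λ ()

    side-false : ∀ {x y z} → side x y z ≡ false → Star (OtherEdge x y) z y
    side-false {x} {y} {z} with walkToEndpoint x y z
    ... | inj₁ _ = λ ()
    ... | inj₂ p = const p

    no-both-ends : ∀ {x y z} → Adj x y → Star (OtherEdge x y) z x → ¬ Star (OtherEdge x y) z y
    no-both-ends xy p q = no-bypass xy (Star.reverse OtherEdge-sym p ◅◅ q)

    reach-x⇒side : ∀ {x y z} → Adj x y → Star (OtherEdge x y) z x → side x y z ≡ true
    reach-x⇒side {x} {y} {z} xy p with side x y z in eq
    ... | true  = refl
    ... | false = ⊥-elim (no-both-ends xy p (side-false eq))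

    reach-y⇒side : ∀ {x y z} → Adj x y → Star (OtherEdge x y) z y → side x y z ≡ false
    reach-y⇒side {x} {y} {z} xy q with side x y z in eq
    ... | true  = ⊥-elim (no-both-ends xy (side-true eq) q)
    ... | false = refl

    side-along : ∀ {x y z z′} → Adj x y → Star (OtherEdge x y) z z′ → side x y z ≡ side x y z′
    side-along {x} {y} {z} {z′} xy p with side x y z′ in eq
    ... | true  = reach-x⇒side xy (p ◅◅ side-true eq)
    ... | false = reach-y⇒side xy (p ◅◅ side-false eq)

    side-swap : ∀ {x y} z → Adj x y → side y x z ≡ not (side x y z)
    side-swap {x} {y} z xy with side x y z in eq
    ... | true  = reach-y⇒side (Adj-sym xy) (Star.map OtherEdge-swap (side-true eq))
    ... | false = reach-x⇒side (Adj-sym xy) (Star.map OtherEdge-swap (side-false eq))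

    Separates : Fin n → Fin n → Rel (Fin n) 0ℓ
    Separates s t x y = Adj x y × side x y s ≢ side x y t

    Separates-sym : ∀ {s t} → Symmetric (Separates s t)
    Separates-sym {s} {t} (xy , ne) =
      Adj-sym xy , λ eq → ne (not-injective (trans (sym (side-swap s xy)) (trans eq (side-swap t xy))))

    avoid-vertex : ∀ {s y w vs t} → Path Adj w vs t → All (s ≢_) (w ∷ vs) → Star (OtherEdge s y) w t
    avoid-vertex ε _ = ε
    avoid-vertex (e ◅ p) (s≢a ∷ s∉@(s≢b ∷ _)) =
      (e , λ { (inj₁ (a≡s , _)) → s≢a (sym a≡s) ; (inj₂ (_ , b≡s)) → s≢b (sym b≡s) })
        ◅ avoid-vertex p s∉

    first-edge-separates : ∀ {s w t} → Adj s w → Star (OtherEdge s w) w t → Separates s t s w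
    first-edge-separates {s} {w} {t} sw p = sw , λ eq → contradiction
      (trans (sym (reach-x⇒side sw ε)) (trans eq (trans (sym (side-along sw p)) (reach-y⇒side sw ε))))
      λ ()

    Separates-prepend : ∀ {s t w a b} → Separates s t s w → Separates w t a b → Separates s t a b
    Separates-prepend {s} {t} {w} {a} {b} sw (ab , ne) with sameEdge? a b s w
    ... | yes (inj₁ (refl , refl)) = sw
    ... | yes (inj₂ (refl , refl)) = Separates-sym sw
    ... | no other = ab , ne ∘ trans (sym (side-along ab ((proj₁ sw , other) ◅ ε)))

    simplePath-separates : ∀ {s vs t} → Path Adj s vs t → Unique (s ∷ vs) → Star (Separates s t) s t
    simplePath-separates ε _ = ε
    simplePath-separates (e ◅ p) (s∉ ∷ unique) =
      first ◅ Star.map (Separates-prepend first) (simplePath-separates p unique)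
      where first = first-edge-separates e (avoid-vertex p s∉)

    separating-walk : ∀ s t → Star (Separates s t) s t
    separating-walk s t with simplePath (Walk⇒Star (connected s t))
    ... | _ , p , unique = simplePath-separates p unique

    crossing : ∀ {R : Rel (Fin n) 0ℓ} → R ⇒ Adj → Symmetric R → ∀ {x y s t} → Adj x y →
               Star R s t → side x y s ≢ side x y t → Star R s x × R x y
    crossing R⊆Adj R-sym xy ε ne = ⊥-elim (ne refl)
    crossing R⊆Adj R-sym {x} {y} {s} xy (_◅_ {j = s′} r walk) ne with sameEdge? x y s s′
    ... | yes (inj₁ (refl , refl)) = ε , r
    ... | yes (inj₂ (refl , refl)) = r ◅ ε , R-sym r
    ... | no other = Prod.map₁ (r ◅_)
      (crossing R⊆Adj R-sym xy walk (ne ∘ trans (side-along xy ((R⊆Adj r , other) ◅ ε))))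

    Splitting : Fin n → Fin n → Fin n → Fin n → Fin n → Bool
    Splitting u v w x y = adj T x y ∧ splits (side x y u) (side x y v) (side x y w)

    Splitting⇒Adj : ∀ {u v w x y} → Splitting u v w x y ≡ true → Adj x y
    Splitting⇒Adj {x = x} {y} h with adj T x y
    ... | true  = refl
    ... | false = h

    Splitting⇒Separates : ∀ {u v w x y} → Splitting u v w x y ≡ true →
                          Separates u v x y ⊎ Separates u w x y
    Splitting⇒Separates {x = x} {y} h with adj T x y
    ... | true = Sum.map (refl ,_) (refl ,_) (splits⇒≢ _ _ _ h)

    Separates⇒Splittingᵛ : ∀ {u v w x y} → Separates u v x y → Splitting u v w x y ≡ true
    Separates⇒Splittingᵛ {w = w} {x} {y} (xy , ne) rewrite xy = ≢⇒splitsˡ (side x y w) ne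

    Separates⇒Splittingʷ : ∀ {u v w x y} → Separates u w x y → Splitting u v w x y ≡ true
    Separates⇒Splittingʷ {v = v} {x = x} {y} (xy , ne) rewrite xy = ≢⇒splitsʳ (side x y v) ne

    Splitting-sym : ∀ u v w x y → Splitting u v w x y ≡ Splitting u v w y x
    Splitting-sym u v w x y with adj T x y in xy
    ... | false rewrite trans (Graph.sym T y x) xy = refl
    ... | true rewrite Adj-sym xy | side-swap u xy | side-swap v xy | side-swap w xy =
      sym (splits-not (side x y u) (side x y v) (side x y w))

    separating-edge∈subgraph : ∀ {s t x y} (H : Subgraph T) → SubConnected H →
      W H s ≡ true → W H t ≡ true → Separates s t x y → F H x y ≡ true
    separating-edge∈subgraph H connectedH s∈ t∈ (xy , ne) =
      proj₂ (crossing (λ {a} {b} → F-sub H a b) (λ {a} {b} → trans (F-sym H b a)) xy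
                      (Walk⇒Star (connectedH _ _ s∈ t∈)) ne)

    Splitting⊆spanning : ∀ {u v w} (H : Subgraph T) → Spans H (u ∷ v ∷ w ∷ []) →
                         ∀ x y → Splitting u v w x y ≡ true → F H x y ≡ true
    Splitting⊆spanning H (connectedH , u∈ ∷ v∈ ∷ w∈ ∷ []) x y h =
      Sum.[ separating-edge∈subgraph H connectedH u∈ v∈ , separating-edge∈subgraph H connectedH u∈ w∈ ]
        (Splitting⇒Separates h)

    module SplittingSubgraph (u v w : Fin n) where
      open DecMembership (_≟_ {n}) using (_∈?_)

      SplitEdge : Rel (Fin n) 0ℓ
      SplitEdge x y = Splitting u v w x y ≡ true

      SplitEdge-sym : Symmetric SplitEdge
      SplitEdge-sym {x} {y} = trans (Splitting-sym u v w y x)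

      Touches : Fin n → Set
      Touches z = z ∈ u ∷ v ∷ w ∷ [] ⊎ ∃ (SplitEdge z)

      touches? : ∀ z → Dec (Touches z)
      touches? z = z ∈? (u ∷ v ∷ w ∷ []) ⊎-dec Fin.any? (λ y → Splitting u v w z y Bool.≟ true)

      subgraph : Subgraph T
      subgraph = record
        { W     = does ∘ touches?
        ; F     = Splitting u v w
        ; F-sym = Splitting-sym u v w
        ; F-sub = λ _ _ → Splitting⇒Adj
        ; F-end = λ x y h → dec-true (touches? x) (inj₂ (y , h))
        }

      walk-u-v : Star SplitEdge u v
      walk-u-v = Star.map Separates⇒Splittingᵛ (separating-walk u v)

      walk-u-w : Star SplitEdge u w
      walk-u-w = Star.map Separates⇒Splittingʷ (separating-walk u w)

      walk-from-u : ∀ {z} → Touches z → Star SplitEdge u z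
      walk-from-u (inj₁ (here refl))                 = ε
      walk-from-u (inj₁ (there (here refl)))         = walk-u-v
      walk-from-u (inj₁ (there (there (here refl)))) = walk-u-w
      walk-from-u (inj₂ (_ , h)) with Splitting⇒Separates h
      ... | inj₁ (xy , ne) = proj₁ (crossing Splitting⇒Adj SplitEdge-sym xy walk-u-v ne)
      ... | inj₂ (xy , ne) = proj₁ (crossing Splitting⇒Adj SplitEdge-sym xy walk-u-w ne)

      spans : Spans subgraph (u ∷ v ∷ w ∷ [])
      spans = (λ a b a∈ b∈ → Star⇒Walk (Star.reverse SplitEdge-sym (walk-from-u (from-does (touches? a) a∈))
                                        ◅◅ walk-from-u (from-does (touches? b) b∈)))
            , member (here refl) ∷ member (there (here refl)) ∷ member (there (there (here refl))) ∷ []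
        where
        member : ∀ {z} → z ∈ u ∷ v ∷ w ∷ [] → does (touches? z) ≡ true
        member {z} z∈ = dec-true (touches? z) (inj₁ z∈)

    splittingCount-isSteinerDistance : ∀ u v w →
      IsSteinerDistance T (u ∷ v ∷ w ∷ []) (edgeCount (Splitting u v w))
    splittingCount-isSteinerDistance u v w =
      (subgraph , spans , refl) , λ H spansH → edgeCount-mono (Splitting⊆spanning H spansH)
      where open SplittingSubgraph u v w

    splittingCount-triple : ∀ u v w →
      edgeCount (Splitting u v w) + edgeCount (Splitting u v w) ≡
      edgeCount (Splitting u v v) + edgeCount (Splitting v w w) + edgeCount (Splitting u w w)
    splittingCount-triple u v w = begin
      pairSum Iuvw + pairSum Iuvw
        ≡⟨ sym (pairSum-+ Iuvw Iuvw) ⟩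
      pairSum (λ x y → Iuvw x y + Iuvw x y)
        ≡⟨ pairSum-cong (λ x y → count (toℕ x ℕ.<ᵇ toℕ y) (adj T x y) (side x y u) (side x y v) (side x y w)) ⟩
      pairSum (λ x y → Iuv x y + Ivw x y + Iuw x y)
        ≡⟨ pairSum-+ (λ x y → Iuv x y + Ivw x y) Iuw ⟩
      pairSum (λ x y → Iuv x y + Ivw x y) + pairSum Iuw
        ≡⟨ cong (_+ pairSum Iuw) (pairSum-+ Iuv Ivw) ⟩
      pairSum Iuv + pairSum Ivw + pairSum Iuw ∎
      where
      open ≡-Reasoning
      Iuvw Iuv Ivw Iuw : Fin n → Fin n → ℕ
      Iuvw = edgeIndicator (Splitting u v w)
      Iuv  = edgeIndicator (Splitting u v v)
      Ivw  = edgeIndicator (Splitting v w w)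
      Iuw  = edgeIndicator (Splitting u w w)
      count : ∀ l e a b c →
        indicator (l ∧ (e ∧ splits a b c)) + indicator (l ∧ (e ∧ splits a b c)) ≡
        indicator (l ∧ (e ∧ splits a b b)) + indicator (l ∧ (e ∧ splits b c c))
          + indicator (l ∧ (e ∧ splits a c c))
      count false _     _ _ _ = refl
      count true  false _ _ _ = refl
      count true  true  a b c = splits-count a b c

  steinerDistance-triple : ∀ {n} (T : Graph n) → IsTree T → (d : Fin n → Fin n → Fin n → ℕ) →
    (∀ u v w → IsSteinerDistance T (u ∷ v ∷ w ∷ []) (d u v w)) →
    ∀ u v w → d u v w + d u v w ≡ d u v v + d v w w + d u w w
  steinerDistance-triple T (connected , acyclic) d isSteiner u v w =
    trans (cong₂ _+_ (d≡count u v w) (d≡count u v w))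
          (trans (splittingCount-triple u v w)
                 (sym (cong₂ _+_ (cong₂ _+_ (d≡count u v v) (d≡count v w w)) (d≡count u w w))))
    where
    open Tree T connected acyclic
    d≡count : ∀ u v w → d u v w ≡ edgeCount (Splitting u v w)
    d≡count u v w = IsSteinerDistance-unique (isSteiner u v w) (splittingCount-isSteinerDistance u v w)

module SteinerForms {c ℓ : Level} (K : CommutativeRing c ℓ) where

  import Data.Nat as ℕ
  import Data.Nat.Properties as ℕₚ
  open import Data.Fin using (toℕ)
  open import Data.Product using (proj₁; proj₂)
  open import Function using (_∘_)
  open import Relation.Nullary using (¬_)
  open import Relation.Binary.PropositionalEquality as ≡ using (_≡_)
  import Algebra.Solver.Ring.NaturalCoefficients.Default as NaturalSolver
  open CommutativeRing K hiding (zero)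
  open import Algebra.Properties.Semiring.Sum semiring
    using (sum; sum-syntax; sum-cong-≋; sum-replicate-zero; ∑-distrib-+; ∑-comm; *-distribˡ-sum; *-distribʳ-sum)
  open import Relation.Binary.Reasoning.Setoid setoid
  open NaturalSolver commutativeSemiring using (solve; _:=_; _:+_; _:*_; con)

  natCast-+ : ∀ a b → natCast K (a ℕ.+ b) ≈ natCast K a + natCast K b
  natCast-+ zero    b = sym (+-identityˡ _)
  natCast-+ (suc a) b = trans (+-congˡ (natCast-+ a b)) (sym (+-assoc _ _ _))

  sumFin≈sum : ∀ {n} {f g : Fin n → Carrier} → (∀ i → f i ≈ g i) → sumFin K f ≈ sum g
  sumFin≈sum {zero}  _   = refl
  sumFin≈sum {suc n} f≈g = +-cong (f≈g zero) (sumFin≈sum (f≈g ∘ suc))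

  sum-zero : ∀ {n} {f : Fin n → Carrier} → (∀ i → f i ≈ 0#) → sum f ≈ 0#
  sum-zero {n} f≈0 = trans (sum-cong-≋ f≈0) (sum-replicate-zero n)

  module _ {n : ℕ} where

    Σ2 : (Fin n → Fin n → Carrier) → Carrier
    Σ2 h = ∑[ a < n ] ∑[ b < n ] h a b

    Σ2-cong : ∀ {g h} → (∀ a b → g a b ≈ h a b) → Σ2 g ≈ Σ2 h
    Σ2-cong g≈h = sum-cong-≋ λ a → sum-cong-≋ (g≈h a)

    Σ3 : (Fin n → Fin n → Fin n → Carrier) → Carrier
    Σ3 g = ∑[ a < n ] ∑[ b < n ] ∑[ c < n ] g a b c

    Σ3-cong : ∀ {g h} → (∀ a b c → g a b c ≈ h a b c) → Σ3 g ≈ Σ3 h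
    Σ3-cong g≈h = sum-cong-≋ λ a → sum-cong-≋ λ b → sum-cong-≋ (g≈h a b)

    Σ3-+ : ∀ g h → Σ3 (λ a b c → g a b c + h a b c) ≈ Σ3 g + Σ3 h
    Σ3-+ g h = trans (sum-cong-≋ λ a → trans (sum-cong-≋ λ b → ∑-distrib-+ (g a b) (h a b))
                                             (∑-distrib-+ (λ b → ∑[ c < n ] g a b c) (λ b → ∑[ c < n ] h a b c)))
                     (∑-distrib-+ (λ a → ∑[ b < n ] ∑[ c < n ] g a b c) (λ a → ∑[ b < n ] ∑[ c < n ] h a b c))

    Σ3-rotate : ∀ g → Σ3 (λ a b c → g b c a) ≈ Σ3 g
    Σ3-rotate g = trans (∑-comm (λ a b → ∑[ c < n ] g b c a)) (sum-cong-≋ λ b → ∑-comm (λ a c → g b c a))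

    Σ3-swap : ∀ g → Σ3 (λ a b c → g a c b) ≈ Σ3 g
    Σ3-swap g = sum-cong-≋ λ a → ∑-comm (λ b c → g a c b)

    Σ3-separate : ∀ h y → Σ3 (λ a b c → h a b * y c) ≈ Σ2 h * sum y
    Σ3-separate h y = begin
      Σ3 (λ a b c → h a b * y c)
        ≈⟨ sum-cong-≋ (λ a → sum-cong-≋ λ b → sym (*-distribˡ-sum (h a b) y)) ⟩
      ∑[ a < n ] ∑[ b < n ] (h a b * sum y)
        ≈⟨ sum-cong-≋ (λ a → sym (*-distribʳ-sum (sum y) (h a))) ⟩
      ∑[ a < n ] (∑[ b < n ] h a b * sum y)
        ≈⟨ sym (*-distribʳ-sum (sum y) (λ a → ∑[ b < n ] h a b)) ⟩
      Σ2 h * sum y ∎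

  sum-line : ∀ {n} (f g : Fin n → Carrier) t → sum (λ i → f i + t * g i) ≈ sum f + t * sum g
  sum-line f g t = trans (∑-distrib-+ f (λ i → t * g i)) (+-congˡ (sym (*-distribˡ-sum t g)))

  sum-quadratic : ∀ {n} (f g h : Fin n → Carrier) t →
    sum (λ i → f i + t * g i + (t * t) * h i) ≈ sum f + t * sum g + (t * t) * sum h
  sum-quadratic f g h t = trans (∑-distrib-+ (λ i → f i + t * g i) (λ i → (t * t) * h i))
                                (+-cong (sum-line f g t) (sym (*-distribˡ-sum (t * t) h)))

  Σ2-quadratic : ∀ {n} (f g h : Fin n → Fin n → Carrier) t →
    Σ2 (λ a b → f a b + t * g a b + (t * t) * h a b) ≈ Σ2 f + t * Σ2 g + (t * t) * Σ2 h
  Σ2-quadratic {n} f g h t = trans (sum-cong-≋ λ a → sum-quadratic (f a) (g a) (h a) t)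
    (sum-quadratic (λ a → ∑[ b < n ] f a b) (λ a → ∑[ b < n ] g a b) (λ a → ∑[ b < n ] h a b) t)

  expand-pairwise : ∀ Dab Dbc Dac δa δb δc xa xb xc →
    (Dab + Dbc + Dac) * (δa * (xb * xc) + δb * (xa * xc) + δc * (xa * xb)) ≈
      (Dab * (δa * xb + δb * xa) * xc + Dab * (xa * xb) * δc)
    + (Dbc * (δb * xc + δc * xb) * xa + Dbc * (xb * xc) * δa)
    + (Dac * (δa * xc + δc * xa) * xb + Dac * (xa * xc) * δb)
  expand-pairwise = solve 9 (λ Dab Dbc Dac δa δb δc xa xb xc →
    (Dab :+ Dbc :+ Dac) :* (δa :* (xb :* xc) :+ δb :* (xa :* xc) :+ δc :* (xa :* xb)) :=
      (Dab :* (δa :* xb :+ δb :* xa) :* xc :+ Dab :* (xa :* xb) :* δc)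
    :+ (Dbc :* (δb :* xc :+ δc :* xb) :* xa :+ Dbc :* (xb :* xc) :* δa)
    :+ (Dac :* (δa :* xc :+ δc :* xa) :* xb :+ Dac :* (xa :* xc) :* δb)) refl

  expand-product-line : ∀ D t ya yb za zb →
    D * ((ya + t * za) * (yb + t * zb)) ≈ D * (ya * yb) + t * (D * (ya * zb + za * yb)) + (t * t) * (D * (za * zb))
  expand-product-line = solve 6 (λ D t ya yb za zb →
    D :* ((ya :+ t :* za) :* (yb :+ t :* zb)) :=
      D :* (ya :* yb) :+ t :* (D :* (ya :* zb :+ za :* yb)) :+ (t :* t) :* (D :* (za :* zb))) refl

  module _ {n : ℕ} (d : Fin n → Fin n → Fin n → ℕ) where

    pairDist : Fin n → Fin n → Carrier
    pairDist a b = natCast K (d a b b)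

    quadForm : (Fin n → Carrier) → Carrier
    quadForm x = Σ2 λ a b → pairDist a b * (x a * x b)

    bilinForm : (Fin n → Carrier) → (Fin n → Carrier) → Carrier
    bilinForm y z = Σ2 λ a b → pairDist a b * (y a * z b + z a * y b)

    quadForm-cong : ∀ {x x′} → (∀ i → x i ≈ x′ i) → quadForm x ≈ quadForm x′
    quadForm-cong x≈x′ = Σ2-cong λ a b → *-congˡ (*-cong (x≈x′ a) (x≈x′ b))

    quadForm-line : ∀ y z t →
      quadForm (λ v → y v + t * z v) ≈ quadForm y + t * bilinForm y z + (t * t) * quadForm z
    quadForm-line y z t = trans (Σ2-cong λ a b → expand-product-line (pairDist a b) t (y a) (y b) (z a) (z b))
                                (Σ2-quadratic {n} _ _ _ t)

    HalfPerimeter : Set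
    HalfPerimeter = ∀ a b c → d a b c ℕ.+ d a b c ≡ d a b b ℕ.+ d b c c ℕ.+ d a c c

    steiner3Partial-twice≈0 : HalfPerimeter → ∀ {x} → sum x ≈ 0# → quadForm x ≈ 0# →
      ∀ r → steiner3Partial K d x r + steiner3Partial K d x r ≈ 0#
    steiner3Partial-twice≈0 halfPerimeter {x} Σx≈0 Qx≈0 r = begin
      steiner3Partial K d x r + steiner3Partial K d x r
        ≈⟨ +-cong ∂≈Σ3 ∂≈Σ3 ⟩
      Σ3 nμ + Σ3 nμ
        ≈⟨ sym (Σ3-+ nμ nμ) ⟩
      Σ3 (λ a b c → nμ a b c + nμ a b c)
        ≈⟨ Σ3-cong polarise ⟩
      Σ3 (λ a b c → τ a b c + τ b c a + τ a c b)
        ≈⟨ trans (Σ3-+ _ (λ a b c → τ a c b)) (+-congʳ (Σ3-+ τ (λ a b c → τ b c a))) ⟩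
      Σ3 τ + Σ3 (λ a b c → τ b c a) + Σ3 (λ a b c → τ a c b)
        ≈⟨ +-cong (+-cong Στ≈0 (trans (Σ3-rotate τ) Στ≈0)) (trans (Σ3-swap τ) Στ≈0) ⟩
      0# + 0# + 0#
        ≈⟨ trans (+-identityʳ _) (+-identityʳ 0#) ⟩
      0# ∎
      where
      δr : Fin n → Carrier
      δr a = δ K a r
      μ nμ τ : Fin n → Fin n → Fin n → Carrier
      μ a b c = δr a * (x b * x c) + δr b * (x a * x c) + δr c * (x a * x b)
      nμ a b c = natCast K (d a b c) * μ a b c
      τ a b c = pairDist a b * (δr a * x b + δr b * x a) * x c + pairDist a b * (x a * x b) * δr c

      ∂≈Σ3 : steiner3Partial K d x r ≈ Σ3 nμ
      ∂≈Σ3 = sumFin≈sum {n} λ a → sumFin≈sum {n} λ b → sumFin≈sum {n} λ c → refl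

      polarise : ∀ a b c → nμ a b c + nμ a b c ≈ τ a b c + τ b c a + τ a c b
      polarise a b c = begin
        nμ a b c + nμ a b c
          ≈⟨ sym (distribʳ (μ a b c) _ _) ⟩
        (natCast K (d a b c) + natCast K (d a b c)) * μ a b c
          ≈⟨ *-congʳ (sym (natCast-+ (d a b c) _)) ⟩
        natCast K (d a b c ℕ.+ d a b c) * μ a b c
          ≡⟨ ≡.cong (λ k → natCast K k * μ a b c) (halfPerimeter a b c) ⟩
        natCast K (d a b b ℕ.+ d b c c ℕ.+ d a c c) * μ a b c
          ≈⟨ *-congʳ (trans (natCast-+ (d a b b ℕ.+ d b c c) _) (+-congʳ (natCast-+ (d a b b) _))) ⟩
        (pairDist a b + pairDist b c + pairDist a c) * μ a b c
          ≈⟨ expand-pairwise _ _ _ _ _ _ _ _ _ ⟩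
        τ a b c + τ b c a + τ a c b ∎

      Στ≈0 : Σ3 τ ≈ 0#
      Στ≈0 = begin
        Σ3 τ
          ≈⟨ Σ3-+ {n} _ _ ⟩
        Σ3 (λ a b c → pairDist a b * (δr a * x b + δr b * x a) * x c)
          + Σ3 (λ a b c → pairDist a b * (x a * x b) * δr c)
          ≈⟨ +-cong (Σ3-separate _ x) (Σ3-separate _ δr) ⟩
        Σ2 (λ a b → pairDist a b * (δr a * x b + δr b * x a)) * sum x + quadForm x * sum δr
          ≈⟨ +-cong (trans (*-congˡ Σx≈0) (zeroʳ _)) (trans (*-congʳ Qx≈0) (zeroˡ _)) ⟩
        0# + 0#
          ≈⟨ +-identityʳ 0# ⟩
        0# ∎

  natCast-pos≉0 : CharZero K → ∀ {k} → 1 ℕ.≤ k → ¬ natCast K k ≈ 0#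
  natCast-pos≉0 char0 {suc k} _ = char0 k

  cancel-nonzero : IsFieldR K → ∀ {k p} → ¬ k ≈ 0# → k * p ≈ 0# → p ≈ 0#
  cancel-nonzero (_ , inverse) {k} {p} k≉0 kp≈0 with inverse k k≉0
  ... | k⁻¹ , kk⁻¹≈1 = begin
    p              ≈⟨ sym (*-identityˡ p) ⟩
    1# * p         ≈⟨ *-congʳ (sym kk⁻¹≈1) ⟩
    k * k⁻¹ * p    ≈⟨ *-congʳ (*-comm k k⁻¹) ⟩
    k⁻¹ * k * p    ≈⟨ *-assoc k⁻¹ k p ⟩
    k⁻¹ * (k * p)  ≈⟨ *-congˡ kp≈0 ⟩
    k⁻¹ * 0#       ≈⟨ zeroʳ k⁻¹ ⟩
    0#             ∎

  cancel-double : IsFieldR K → CharZero K → ∀ {p} → p + p ≈ 0# → p ≈ 0#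
  cancel-double isField char0 {p} p+p≈0 = cancel-nonzero isField (char0 1) (trans (double p) p+p≈0)
    where
    double : ∀ p → natCast K 2 * p ≈ p + p
    double = solve 1 (λ p → (con 1 :+ (con 1 :+ con 0)) :* p := p :+ p) refl

  quadratic-root : IsFieldR K → AlgClosed K → ∀ {α} β γ → ¬ α ≈ 0# →
    ∃ λ t → γ + t * β + (t * t) * α ≈ 0#
  quadratic-root (_ , inverse) closed {α} β γ α≉0 = t , (begin
    γ + t * β + (t * t) * α
      ≈⟨ +-congʳ (+-cong (sym (*-identityˡ γ)) (sym (*-identityˡ _))) ⟩
    1# * γ + 1# * (t * β) + (t * t) * α
      ≈⟨ +-congʳ (+-cong (*-congʳ (sym αα⁻¹≈1)) (*-congʳ (sym αα⁻¹≈1))) ⟩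
    α * α⁻¹ * γ + α * α⁻¹ * (t * β) + (t * t) * α
      ≈⟨ make-monic α α⁻¹ β γ t ⟩
    α * (pow K t 2 + sumFin K (λ i → cs i * pow K t (toℕ i)))
      ≈⟨ *-congˡ root ⟩
    α * 0#
      ≈⟨ zeroʳ α ⟩
    0# ∎)
    where
    α⁻¹ : Carrier
    α⁻¹ = proj₁ (inverse α α≉0)
    αα⁻¹≈1 : α * α⁻¹ ≈ 1#
    αα⁻¹≈1 = proj₂ (inverse α α≉0)
    cs : Fin 2 → Carrier
    cs zero       = γ * α⁻¹
    cs (suc zero) = β * α⁻¹
    t : Carrier
    t = proj₁ (closed 1 cs)
    root : pow K t 2 + sumFin K (λ i → cs i * pow K t (toℕ i)) ≈ 0#
    root = proj₂ (closed 1 cs)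
    make-monic : ∀ α α⁻¹ β γ t → α * α⁻¹ * γ + α * α⁻¹ * (t * β) + (t * t) * α ≈
      α * (t * (t * 1#) + (γ * α⁻¹ * 1# + (β * α⁻¹ * (t * 1#) + 0#)))
    make-monic = solve 5 (λ α α⁻¹ β γ t →
      α :* α⁻¹ :* γ :+ α :* α⁻¹ :* (t :* β) :+ (t :* t) :* α :=
        α :* (t :* (t :* con 1) :+ (γ :* α⁻¹ :* con 1 :+ (β :* α⁻¹ :* (t :* con 1) :+ con 0)))) refl

  quadForm-firstTwo : ∀ {m} (d : Fin (suc (suc m)) → Fin (suc (suc m)) → Fin (suc (suc m)) → ℕ) p q →
    quadForm d (extend p q (λ _ → 0#)) ≈
      pairDist d zero zero * (p * p) + pairDist d zero (suc zero) * (p * q)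
      + (pairDist d (suc zero) zero * (q * p) + pairDist d (suc zero) (suc zero) * (q * q))
  quadForm-firstTwo {m} d p q = trans
    (+-cong (+-congˡ (+-congˡ (sum-zero {m} λ _ → vanishes (zeroʳ p))))
            (+-cong (+-congˡ (+-congˡ (sum-zero {m} λ _ → vanishes (zeroʳ q))))
                    (sum-zero {m} λ i → sum-zero λ b →
                       vanishes {pairDist d (suc (suc i)) b} (zeroˡ (extend p q (λ _ → 0#) b)))))
    (drop-zeros _ _ _ _)
    where
    vanishes : ∀ {D e} → e ≈ 0# → D * e ≈ 0#
    vanishes {D} e≈0 = trans (*-congˡ e≈0) (zeroʳ D)
    drop-zeros : ∀ A B C E → A + (B + 0#) + (C + (E + 0#) + 0#) ≈ A + B + (C + E)
    drop-zeros = solve 4 (λ A B C E → A :+ (B :+ con 0) :+ (C :+ (E :+ con 0) :+ con 0) := A :+ B :+ (C :+ E)) refl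

  module NullvectorCompletion {m : ℕ} (isField : IsFieldR K) (closed : AlgClosed K) (char0 : CharZero K)
    (d : Fin (suc (suc m)) → Fin (suc (suc m)) → Fin (suc (suc m)) → ℕ) (halfPerimeter : HalfPerimeter d)
    (d₀₁-pos : 1 ℕ.≤ d zero (suc zero) (suc zero)) (a : Fin m → Carrier) where

    y z : Fin (suc (suc m)) → Carrier
    y = extend 0# (- sum a) a
    z = extend 1# (- 1#) (λ _ → 0#)

    sum-y : sum y ≈ 0#
    sum-y = trans (+-identityˡ _) (-‿inverseˡ (sum a))

    sum-z : sum z ≈ 0#
    sum-z = trans (+-congˡ (trans (+-congˡ (sum-zero {m} λ _ → refl)) (+-identityʳ (- 1#)))) (-‿inverseʳ 1#)

    diagonal≈0 : ∀ u → pairDist d u u ≈ 0#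
    diagonal≈0 u = reflexive (≡.cong (natCast K) (≡.sym
      (ℕₚ.+-cancelˡ-≡ (d u u u ℕ.+ d u u u) 0 (d u u u) (≡.trans (ℕₚ.+-identityʳ _) (halfPerimeter u u u)))))

    quadForm-z : quadForm d z + (pairDist d zero (suc zero) + pairDist d (suc zero) zero) ≈ 0#
    quadForm-z = begin
      quadForm d z + (D₀₁ + D₁₀)
        ≈⟨ +-congʳ (quadForm-firstTwo d 1# (- 1#)) ⟩
      D₀₀ * (1# * 1#) + D₀₁ * (1# * - 1#) + (D₁₀ * (- 1# * 1#) + D₁₁ * (- 1# * - 1#)) + (D₀₁ + D₁₀)
        ≈⟨ +-congʳ (+-cong (+-congʳ (*-congʳ (diagonal≈0 zero)))
                           (+-congˡ (*-congʳ (diagonal≈0 (suc zero))))) ⟩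
      0# * (1# * 1#) + D₀₁ * (1# * - 1#) + (D₁₀ * (- 1# * 1#) + 0# * (- 1# * - 1#)) + (D₀₁ + D₁₀)
        ≈⟨ collect D₀₁ D₁₀ (- 1#) ⟩
      (D₀₁ + D₁₀) * (- 1# + 1#)
        ≈⟨ *-congˡ (-‿inverseˡ 1#) ⟩
      (D₀₁ + D₁₀) * 0#
        ≈⟨ zeroʳ _ ⟩
      0# ∎
      where
      D₀₀ D₀₁ D₁₀ D₁₁ : Carrier
      D₀₀ = pairDist d zero zero
      D₀₁ = pairDist d zero (suc zero)
      D₁₀ = pairDist d (suc zero) zero
      D₁₁ = pairDist d (suc zero) (suc zero)
      collect : ∀ A B n → 0# * (1# * 1#) + A * (1# * n) + (B * (n * 1#) + 0# * (n * n)) + (A + B) ≈ (A + B) * (n + 1#)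
      collect = solve 3 (λ A B n →
        con 0 :* (con 1 :* con 1) :+ A :* (con 1 :* n) :+ (B :* (n :* con 1) :+ con 0 :* (n :* n)) :+ (A :+ B) :=
          (A :+ B) :* (n :+ con 1)) refl

    quadForm-z≉0 : ¬ quadForm d z ≈ 0#
    quadForm-z≉0 Qz≈0 = natCast-pos≉0 char0 (ℕₚ.≤-trans d₀₁-pos (ℕₚ.m≤m+n _ _)) (begin
      natCast K (d zero (suc zero) (suc zero) ℕ.+ d (suc zero) zero zero)
        ≈⟨ natCast-+ (d zero (suc zero) (suc zero)) _ ⟩
      pairDist d zero (suc zero) + pairDist d (suc zero) zero
        ≈⟨ sym (+-identityˡ _) ⟩
      0# + (pairDist d zero (suc zero) + pairDist d (suc zero) zero)
        ≈⟨ +-congʳ (sym Qz≈0) ⟩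
      quadForm d z + (pairDist d zero (suc zero) + pairDist d (suc zero) zero)
        ≈⟨ quadForm-z ⟩
      0# ∎)

    root : ∃ λ t → quadForm d y + t * bilinForm d y z + (t * t) * quadForm d z ≈ 0#
    root = quadratic-root isField closed (bilinForm d y z) (quadForm d y) quadForm-z≉0

    t : Carrier
    t = proj₁ root

    x : Fin (suc (suc m)) → Carrier
    x v = y v + t * z v

    sum-x : sum x ≈ 0#
    sum-x = trans (sum-line y z t) (trans (+-cong sum-y (trans (*-congˡ sum-z) (zeroʳ t))) (+-identityʳ 0#))

    quadForm-x : quadForm d x ≈ 0#
    quadForm-x = trans (quadForm-line d y z t) (proj₂ root)

    a₁ a₂ : Carrier
    a₁ = x zero
    a₂ = x (suc zero)

    extend≈x : ∀ v → extend a₁ a₂ a v ≈ x v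
    extend≈x zero          = refl
    extend≈x (suc zero)    = refl
    extend≈x (suc (suc i)) = sym (trans (+-congˡ (zeroʳ t)) (+-identityʳ (a i)))

    isNullvector : ∀ r → steiner3Partial K d (extend a₁ a₂ a) r ≈ 0#
    isNullvector r = cancel-double isField char0 (steiner3Partial-twice≈0 d halfPerimeter {extend a₁ a₂ a}
      (trans (sum-cong-≋ extend≈x) sum-x) (trans (quadForm-cong d extend≈x) quadForm-x) r)

mainTheorem11 : ∀ {c ℓ : Level} (K : CommutativeRing c ℓ) →
    IsFieldR K → AlgClosed K → CharZero K →
    (m : ℕ) (T : Graph (suc (suc m))) → IsTree T →
    (d : Fin (suc (suc m)) → Fin (suc (suc m)) → Fin (suc (suc m)) → ℕ) →
    (∀ u v w → IsSteinerDistance T (u ∷ v ∷ w ∷ []) (d u v w)) →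
    (a : Fin m → CommutativeRing.Carrier K) →
    ∃ λ a1 → ∃ λ a2 → ∀ (r : Fin (suc (suc m))) →
      CommutativeRing._≈_ K (steiner3Partial K d (extend a1 a2 a) r) (CommutativeRing.0# K)
mainTheorem11 K isField closed char0 m T isTree d isSteiner a = a₁ , a₂ , isNullvector
  where
  open SteinerTrees using (steinerDistance-triple; IsSteinerDistance-pos)
  open SteinerForms.NullvectorCompletion K isField closed char0 d (steinerDistance-triple T isTree d isSteiner)
    (IsSteinerDistance-pos (isSteiner zero (suc zero) (suc zero)) λ ()) a
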